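{- For all integers $n\ge2$ and all $k$, the polynomials $A(n,k;u,d)$ satisfy $$A(n,k;u,d)=(k+1+(n-1)d)\,A(n-1,k;u,d)+(n-k+(n-1)u)\,A(n-1,k-1;u,d),$$ with initial condition $A(1,0;u,d)=1$ (and $A(n,k;u,d)=0$ unless $0\le k\le n-1$).
   Context: A tile is a positive integer $m$ (its value) together with a marker that is either absent (tile written $m$), an up-arrow ($m\!\uparrow$) or a down-arrow ($m\!\downarrow$). For $n\ge1$ the set $\mathrm{GS}_n$ of generalized permutations of $[n]$ consists of words $\pi=\pi_1\cdots\pi_n$ of tiles, each with an ascent set $\mathrm{asc}(\pi)$, defined recursively. $\mathrm{GS}_1$ contains only the word consisting of the unmarked tile $1$, with $\mathrm{asc}=\emptyset$. For $n\ge2$, $\mathrm{GS}_n$ consists of all words $\pi'$ obtained from some $\pi=\pi_1\cdots\pi_{n-1}\in\mathrm{GS}_{n-1}$ by one of: (i) insert the unmarked tile $n$ into gap $j$, $0\le j\le n-1$, i.e. $\pi'=\pi_1\cdots\pi_j\, n\,\pi_{j+1}\cdots\pi_{n-1}$; if $j=0$ then $\mathrm{asc}(\pi')=\{a+1: a\in\mathrm{asc}(\pi)\}$, and if $1\le j\le n-1$ then $\mathrm{asc}(\pi')=\{a\in\mathrm{asc}(\pi): a<j\}\cup\{j\}\cup\{a+1: a\in\mathrm{asc}(\pi),\ a>j\}$; (ii) insert $n\!\uparrow$ immediately to the left of $\pi_i$, $1\le i\le n-1$; then $\mathrm{asc}(\pi')=\{a\in\mathrm{asc}(\pi): a<i\}\cup\{i\}\cup\{a+1: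 a\in\mathrm{asc}(\pi),\ a\ge i\}$; (iii) insert $n\!\downarrow$ immediately to the left of $\pi_i$, $1\le i\le n-1$; then $\mathrm{asc}(\pi')=\{a\in\mathrm{asc}(\pi): a<i\}\cup\{a+1: a\in\mathrm{asc}(\pi),\ a\ge i\}$. Each word of $\mathrm{GS}_n$ arises from a unique $\pi$ and insertion, so $\mathrm{asc}$ is well defined. For $\pi\in\mathrm{GS}_n$ let $\mathrm{nua}(\pi)$ and $\mathrm{nda}(\pi)$ be the numbers of tiles of $\pi$ carrying an up-arrow and a down-arrow, respectively. Define $A(n,k;u,d)=\sum u^{\mathrm{nua}(\pi)}d^{\mathrm{nda}(\pi)}$, the sum over all $\pi\in\mathrm{GS}_n$ with $|\mathrm{asc}(\pi)|=k$. -}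

module Defs where

open import Level using (Level)
open import Data.Nat as ℕ using (ℕ; zero; suc; _<?_; _≤?_)
open import Data.Integer as ℤ using (ℤ; +_; -[1+_])
open import Data.List using (List; []; _∷_; _++_; [_]; map; filter; length; concatMap; upTo)
open import Data.Product using (_×_; _,_; proj₁; proj₂)
open import Relation.Nullary using (yes; no)
open import Algebra.Bundles using (CommutativeRing)

data Marker : Set where
  unmarked up down : Marker

Tile : Set
Tile = ℕ × Marker

-- A generalized permutation together with its ascent set (a list of
-- distinct naturals; built literally from the set-builder formulas)
GP : Set
GP = List Tile × List ℕ

-- insert x at gap j (after the first j letters)
insertAt : {A : Set} → ℕ → A → List A → List A
insertAt zero    x ys       = x ∷ ys
insertAt (suc j) x []       = x ∷ []
insertAt (suc j) x (y ∷ ys) = y ∷ insertAt j x ys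

below : ℕ → List ℕ → List ℕ
below j = filter (λ a → a <? j)

above : ℕ → List ℕ → List ℕ
above j = filter (λ a → j <? a)

atLeast : ℕ → List ℕ → List ℕ
atLeast i = filter (λ a → i ≤? a)

-- rule (i): insert unmarked n into gap j
ascI : ℕ → List ℕ → List ℕ
ascI zero    S = map suc S
ascI (suc j) S = below (suc j) S ++ [ suc j ] ++ map suc (above (suc j) S)

-- rule (ii): insert n↑ immediately left of π_i
ascII : ℕ → List ℕ → List ℕ
ascII i S = below i S ++ [ i ] ++ map suc (atLeast i S)

-- rule (iii): insert n↓ immediately left of π_i
ascIII : ℕ → List ℕ → List ℕ
ascIII i S = below i S ++ map suc (atLeast i S)

-- all children in GS_n of π ∈ GS_{n-1}, where n = suc m (so π has m letters)
children : ℕ → GP → List GP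
children m (w , S) =
     map (λ j → insertAt j (n , unmarked) w , ascI j S) (upTo (suc m))
  ++ map (λ i → insertAt i (n , up)   w , ascII (suc i) S) (upTo m)
  ++ map (λ i → insertAt i (n , down) w , ascIII (suc i) S) (upTo m)
  where n = suc m

-- GS n (GS 0 is empty: generalized permutations are only defined for n ≥ 1)
GS : ℕ → List GP
GS zero          = []
GS (suc zero)    = (((1 , unmarked) ∷ []) , []) ∷ []
GS (suc (suc m)) = concatMap (children (suc m)) (GS (suc m))

isUp : Tile → ℕ
isUp (_ , up) = 1
isUp _        = 0

isDown : Tile → ℕ
isDown (_ , down) = 1
isDown _          = 0

nua : List Tile → ℕ
nua []       = 0
nua (t ∷ ts) = isUp t ℕ.+ nua ts

nda : List Tile → ℕ
nda []       = 0
nda (t ∷ ts) = isDown t ℕ.+ nda ts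

-- A(n,k;u,d) evaluated in an arbitrary commutative ring
module Poly {c ℓ : Level} (R : CommutativeRing c ℓ) where
  open CommutativeRing R

  pow : Carrier → ℕ → Carrier
  pow x zero    = 1#
  pow x (suc m) = x * pow x m

  fromℕ : ℕ → Carrier
  fromℕ zero    = 0#
  fromℕ (suc m) = 1# + fromℕ m

  fromℤ : ℤ → Carrier
  fromℤ (+ m)      = fromℕ m
  fromℤ -[1+ m ]   = - fromℕ (suc m)

  weight : ℤ → Carrier → Carrier → GP → Carrier
  weight k u d (w , S) with + length S ℤ.≟ k
  ... | yes _ = pow u (nua w) * pow d (nda w)
  ... | no  _ = 0#

  sumR : List Carrier → Carrier
  sumR []       = 0#
  sumR (x ∷ xs) = x + sumR xs

  A : ℕ → ℤ → Carrier → Carrier → Carrier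
  A n k u d = sumR (map (weight k u d) (GS n))

module Submission where

-- The recurrence is proved one parent at a time.  Let π = (w , S) ∈ GS_p
-- have s = |S| ascents, and let X, Y be its weight counted with s, resp.
-- s + 1, ascents.  Its 2p + 1 children contribute
--   gap 0 and the s gaps t ∈ S (rule (i), no new ascent):     (1 + s) X,
--   the p - s gaps 1 ≤ t ≤ p, t ∉ S (rule (i), new ascent):    (p - s) Y,
--   the p up-arrows (rule (ii), new ascent, factor u):         p u Y,
--   the p down-arrows (rule (iii), no new ascent, factor d):   p d X.

open import Defs
open import Data.Nat using (ℕ; _≤_; _∸_)
open import Data.Integer as ℤ using (ℤ; +_)
open import Data.Product using (_×_)
open import Data.Sum using (_⊎_)
open import Algebra.Bundles using (CommutativeRing)

open import Data.Bool using (true; false; if_then_else_)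
open import Data.Empty using (⊥-elim)
open import Data.Integer using (-[1+_])
import Data.Integer.Properties as ℤP
open import Data.List using (List; []; _∷_; _++_; map; filter; concatMap; length; upTo; applyUpTo)
open import Data.List.Properties
  using (length-map; length-++; length-upTo; map-cong; map-∘; map-applyUpTo; map-upTo; filter-accept; filter-reject)
open import Data.List.Relation.Unary.All as All using (All; []; _∷_)
import Data.List.Relation.Unary.All.Properties as All
open import Data.List.Relation.Unary.AllPairs as AllPairs using (AllPairs; []; _∷_)
import Data.List.Relation.Unary.AllPairs.Properties as AllPairs
open import Data.Nat as ℕ using (zero; suc; _<_; _≡ᵇ_; _<?_; _≤?_; z≤n; s≤s)
open import Data.Nat.ListAction using (sum)
open import Data.Nat.Properties
  using ( _≟_; ≡⇒≡ᵇ; ≡ᵇ⇒≡; <-cmp; <⇒≱; ≮⇒≥; <⇒≢; <⇒≤; <-≤-trans; ≤-refl; ≤-reflexive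
        ; m≤n⇒m≤1+n; m≤m+n; +-suc; *-suc; m+[n∸m]≡n; m+n∸m≡n)
import Data.Nat.Properties as ℕP
open import Data.Nat.Tactic.RingSolver using (solve-∀)
open import Data.Product using (_,_; proj₁; proj₂)
open import Data.Sum using (inj₁; inj₂)
open import Function using (id)
open import Relation.Binary.Definitions using (tri<; tri≈; tri>)
open import Relation.Binary.PropositionalEquality
  using (_≡_; _≢_; refl; sym; trans; cong; cong₂; subst; ≢-sym; module ≡-Reasoning)
open import Relation.Nullary using (yes; no)
open import Relation.Unary using (Decidable)
import Algebra.Properties.CommutativeSemigroup ℕP.+-commutativeSemigroup as ℕ+

-- Kronecker delta on ℕ; it is defined through _≡ᵇ_ so that
-- δ (suc a) (suc b) reduces to δ a b.
δ : ℕ → ℕ → ℕ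
δ a b = if a ≡ᵇ b then 1 else 0

δ-refl : ∀ a → δ a a ≡ 1
δ-refl a with a ≡ᵇ a | ≡⇒≡ᵇ a a refl
... | true | _ = refl

δ-≢ : ∀ {a b} → a ≢ b → δ a b ≡ 0
δ-≢ {a} {b} a≢b with a ≡ᵇ b | ≡ᵇ⇒≡ a b
... | true  | a≡b = ⊥-elim (a≢b (a≡b _))
... | false | _   = refl

occ : ℕ → List ℕ → ℕ
occ a S = sum (map (δ a) S)

length-below-occ-above : ∀ t S → length (below t S) ℕ.+ occ t S ℕ.+ length (above t S) ≡ length S
length-below-occ-above t [] = refl
length-below-occ-above t (a ∷ S) with <-cmp a t
... | tri< a<t a≢t a≯t
  rewrite filter-accept (_<? t) {xs = S} a<t | filter-reject (t <?_) {xs = S} a≯t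
        | δ-≢ {t} {a} (≢-sym a≢t)
  = cong suc (length-below-occ-above t S)
... | tri≈ a≮t refl a≯t
  rewrite filter-reject (_<? t) {xs = S} a≮t | filter-reject (t <?_) {xs = S} a≯t | δ-refl t
  = trans (cong (ℕ._+ length (above t S)) (+-suc _ _)) (cong suc (length-below-occ-above t S))
... | tri> a≮t a≢t t<a
  rewrite filter-reject (_<? t) {xs = S} a≮t | filter-accept (t <?_) {xs = S} t<a
        | δ-≢ {t} {a} (≢-sym a≢t)
  = trans (+-suc _ _) (cong suc (length-below-occ-above t S))

length-below-atLeast : ∀ i S → length (below i S) ℕ.+ length (atLeast i S) ≡ length S
length-below-atLeast i [] = refl
length-below-atLeast i (a ∷ S) with a <? i
... | yes a<i rewrite filter-accept (_<? i) {xs = S} a<i | filter-reject (i ≤?_) {xs = S} (<⇒≱ a<i)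
  = cong suc (length-below-atLeast i S)
... | no a≮i rewrite filter-reject (_<? i) {xs = S} a≮i | filter-accept (i ≤?_) {xs = S} (≮⇒≥ a≮i)
  = trans (+-suc _ _) (cong suc (length-below-atLeast i S))

-- Sizes of the new ascent sets produced by rules (i)–(iii).  Rule (i) at a
-- positive gap t creates a new ascent exactly when t is not yet an ascent.
length-ascI : ∀ t S → length (ascI (suc t) S) ℕ.+ occ (suc t) S ≡ suc (length S)
length-ascI t S = begin
  length (below t′ S ++ t′ ∷ map suc (above t′ S)) ℕ.+ occ t′ S
    ≡⟨ cong (ℕ._+ occ t′ S) (length-++ (below t′ S)) ⟩
  length (below t′ S) ℕ.+ suc (length (map suc (above t′ S))) ℕ.+ occ t′ S
    ≡⟨ cong (λ n → length (below t′ S) ℕ.+ suc n ℕ.+ occ t′ S) (length-map suc (above t′ S)) ⟩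
  length (below t′ S) ℕ.+ suc (length (above t′ S)) ℕ.+ occ t′ S
    ≡⟨ reorder (length (below t′ S)) (length (above t′ S)) (occ t′ S) ⟩
  suc (length (below t′ S) ℕ.+ occ t′ S ℕ.+ length (above t′ S))
    ≡⟨ cong suc (length-below-occ-above t′ S) ⟩
  suc (length S) ∎
  where
  open ≡-Reasoning
  t′ = suc t
  reorder : ∀ x y z → x ℕ.+ suc y ℕ.+ z ≡ suc (x ℕ.+ z ℕ.+ y)
  reorder = solve-∀

length-ascII : ∀ i S → length (ascII i S) ≡ suc (length S)
length-ascII i S = begin
  length (below i S ++ i ∷ map suc (atLeast i S))        ≡⟨ length-++ (below i S) ⟩
  length (below i S) ℕ.+ suc (length (map suc (atLeast i S)))
    ≡⟨ cong (λ n → length (below i S) ℕ.+ suc n) (length-map suc (atLeast i S)) ⟩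
  length (below i S) ℕ.+ suc (length (atLeast i S))     ≡⟨ +-suc _ _ ⟩
  suc (length (below i S) ℕ.+ length (atLeast i S))     ≡⟨ cong suc (length-below-atLeast i S) ⟩
  suc (length S) ∎
  where open ≡-Reasoning

length-ascIII : ∀ i S → length (ascIII i S) ≡ length S
length-ascIII i S = begin
  length (below i S ++ map suc (atLeast i S))           ≡⟨ length-++ (below i S) ⟩
  length (below i S) ℕ.+ length (map suc (atLeast i S))
    ≡⟨ cong (length (below i S) ℕ.+_) (length-map suc (atLeast i S)) ⟩
  length (below i S) ℕ.+ length (atLeast i S)           ≡⟨ length-below-atLeast i S ⟩
  length S ∎
  where open ≡-Reasoning

-- The ascent sets of permutations with p letters are strictly increasing
-- lists with entries in [1, p].  This is the only structural information
-- about GS that the recurrence needs.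
Increasing : List ℕ → Set
Increasing = AllPairs _<_

InRange : ℕ → ℕ → Set
InRange p a = 1 ≤ a × a ≤ p

AscentSet : ℕ → List ℕ → Set
AscentSet p S = Increasing S × All (InRange p) S

ascentSet-filter : ∀ {p S} {P : ℕ → Set} (P? : Decidable P) → AscentSet p S → AscentSet p (filter P? S)
ascentSet-filter P? (inc , rng) = AllPairs.filter⁺ P? inc , All.filter⁺ P? rng

module _ {p b : ℕ} {X Z : List ℕ} (AX : AscentSet p X) (AZ : AscentSet p Z)
         (X<b : All (_< b) X) (b≤Z : All (b ≤_) Z) where

  private
    b<sucZ : All (b <_) (map suc Z)
    b<sucZ = All.map⁺ (All.map s≤s b≤Z)

    increasing-sucZ : Increasing (map suc Z)
    increasing-sucZ = AllPairs.map⁺ (AllPairs.map s≤s (proj₁ AZ))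

    increasing-join : ∀ {Y} → Increasing Y → All (b ≤_) Y → Increasing (X ++ Y)
    increasing-join incY b≤Y =
      AllPairs.++⁺ (proj₁ AX) incY (All.map (λ x<b → All.map (<-≤-trans x<b) b≤Y) X<b)

    inRange-X : All (InRange (suc p)) X
    inRange-X = All.map (λ (1≤a , a≤p) → 1≤a , m≤n⇒m≤1+n a≤p) (proj₂ AX)

    inRange-sucZ : All (InRange (suc p)) (map suc Z)
    inRange-sucZ = All.map⁺ (All.map (λ (_ , a≤p) → s≤s z≤n , s≤s a≤p) (proj₂ AZ))

  ascentSet-insert : InRange (suc p) b → AscentSet (suc p) (X ++ b ∷ map suc Z)
  ascentSet-insert b-in-range =
    increasing-join (b<sucZ ∷ increasing-sucZ) (≤-refl ∷ All.map <⇒≤ b<sucZ) ,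
    All.++⁺ inRange-X (b-in-range ∷ inRange-sucZ)

  ascentSet-shift : AscentSet (suc p) (X ++ map suc Z)
  ascentSet-shift = increasing-join increasing-sucZ (All.map <⇒≤ b<sucZ) , All.++⁺ inRange-X inRange-sucZ

ascentSet-ascI : ∀ {p S} → AscentSet p S → ∀ {j} → j < suc p → AscentSet (suc p) (ascI j S)
ascentSet-ascI AS {zero} _ =
  ascentSet-shift {b = 1} ([] , []) AS [] (All.map proj₁ (proj₂ AS))
ascentSet-ascI {S = S} AS {suc t} (s≤s t<p) =
  ascentSet-insert (ascentSet-filter (_<? suc t) AS) (ascentSet-filter (suc t <?_) AS)
    (All.all-filter (_<? suc t) S) (All.map <⇒≤ (All.all-filter (suc t <?_) S))
    (s≤s z≤n , m≤n⇒m≤1+n t<p)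

ascentSet-ascII : ∀ {p S} → AscentSet p S → ∀ {i} → i < p → AscentSet (suc p) (ascII (suc i) S)
ascentSet-ascII {S = S} AS {i} i<p =
  ascentSet-insert (ascentSet-filter (_<? suc i) AS) (ascentSet-filter (suc i ≤?_) AS)
    (All.all-filter (_<? suc i) S) (All.all-filter (suc i ≤?_) S)
    (s≤s z≤n , m≤n⇒m≤1+n i<p)

ascentSet-ascIII : ∀ {p S} → AscentSet p S → ∀ i → AscentSet (suc p) (ascIII (suc i) S)
ascentSet-ascIII {S = S} AS i =
  ascentSet-shift (ascentSet-filter (_<? suc i) AS) (ascentSet-filter (suc i ≤?_) AS)
    (All.all-filter (_<? suc i) S) (All.all-filter (suc i ≤?_) S)

HasAscentSet : ℕ → GP → Set
HasAscentSet p π = AscentSet p (proj₂ π)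

ascentSet-children : ∀ {p} π → HasAscentSet p π → All (HasAscentSet (suc p)) (children p π)
ascentSet-children {p} π AS =
  All.++⁺ (All.map⁺ (All.applyUpTo⁺₁ id (suc p) (ascentSet-ascI AS)))
    (All.++⁺ (All.map⁺ (All.applyUpTo⁺₁ id p (ascentSet-ascII AS)))
             (All.map⁺ (All.applyUpTo⁺₂ id p (ascentSet-ascIII AS))))

ascentSets-GS : ∀ m → All (HasAscentSet (suc m)) (GS (suc m))
ascentSets-GS zero    = ([] , []) ∷ []
ascentSets-GS (suc m) = All.concat⁺ (All.map⁺ (All.map (ascentSet-children _) (ascentSets-GS m)))

sum-map-+ : ∀ {A : Set} (f g : A → ℕ) xs →
            sum (map (λ x → f x ℕ.+ g x) xs) ≡ sum (map f xs) ℕ.+ sum (map g xs)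
sum-map-+ f g []       = refl
sum-map-+ f g (x ∷ xs) = begin
  f x ℕ.+ g x ℕ.+ sum (map (λ x → f x ℕ.+ g x) xs)       ≡⟨ cong (f x ℕ.+ g x ℕ.+_) (sum-map-+ f g xs) ⟩
  f x ℕ.+ g x ℕ.+ (sum (map f xs) ℕ.+ sum (map g xs))   ≡⟨ ℕ+.interchange (f x) (g x) _ _ ⟩
  f x ℕ.+ sum (map f xs) ℕ.+ (g x ℕ.+ sum (map g xs))   ∎
  where open ≡-Reasoning

sum-const : ∀ {A : Set} c (xs : List A) → sum (map (λ _ → c) xs) ≡ c ℕ.* length xs
sum-const c []       = sym (ℕP.*-zeroʳ c)
sum-const c (x ∷ xs) = trans (cong (c ℕ.+_) (sum-const c xs)) (sym (*-suc c (length xs)))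

map-applyUpTo-suc : ∀ {A : Set} (h : ℕ → A) n → map h (applyUpTo suc n) ≡ map (λ t → h (suc t)) (upTo n)
map-applyUpTo-suc h n = trans (map-applyUpTo suc h n) (sym (map-upTo (λ t → h (suc t)) n))

hit-once : ∀ n a → a < n → sum (map (λ t → δ t a) (upTo n)) ≡ 1
hit-once (suc n) zero    _         =
  cong suc (trans (cong sum (map-applyUpTo-suc (λ t → δ t 0) n)) (sum-const 0 (upTo n)))
hit-once (suc n) (suc a) (s≤s a<n) =
  trans (cong sum (map-applyUpTo-suc (λ t → δ t (suc a)) n)) (hit-once n a a<n)

occ-above : ∀ {t S} → All (t <_) S → occ t S ≡ 0
occ-above []                          = refl
occ-above {t} {a ∷ S} (t<a ∷ t<S) = cong₂ ℕ._+_ (δ-≢ (<⇒≢ t<a)) (occ-above t<S)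

occ-≤1 : ∀ t {S} → Increasing S → occ t S ≤ 1
occ-≤1 t []                      = z≤n
occ-≤1 t {a ∷ S} (a<S ∷ inc) with t ≟ a
... | yes refl = ≤-reflexive (cong₂ ℕ._+_ (δ-refl t) (occ-above a<S))
... | no t≢a   = subst (_≤ 1) (sym (cong (ℕ._+ occ t S) (δ-≢ t≢a))) (occ-≤1 t inc)

-- Every entry of a list with entries in [1, p] is one of 1, …, p, so
-- summing the occurrences of 1, …, p counts the list.
occ-total : ∀ {p S} → All (InRange p) S → sum (map (λ t → occ (suc t) S) (upTo p)) ≡ length S
occ-total {p} {[]} [] = sum-const 0 (upTo p)
occ-total {p} {suc a ∷ S} ((_ , a<p) ∷ rng) = begin
  sum (map (λ t → δ t a ℕ.+ occ (suc t) S) (upTo p))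
    ≡⟨ sum-map-+ (λ t → δ t a) (λ t → occ (suc t) S) (upTo p) ⟩
  sum (map (λ t → δ t a) (upTo p)) ℕ.+ sum (map (λ t → occ (suc t) S) (upTo p))
    ≡⟨ cong₂ ℕ._+_ (hit-once p a a<p) (occ-total rng) ⟩
  suc (length S) ∎
  where open ≡-Reasoning

misses : ℕ → List ℕ → ℕ
misses p S = sum (map (λ t → 1 ∸ occ (suc t) S) (upTo p))

occ-total+misses : ∀ {p S} → AscentSet p S → length S ℕ.+ misses p S ≡ p
occ-total+misses {p} {S} (inc , rng) = begin
  length S ℕ.+ misses p S
    ≡⟨ cong (ℕ._+ misses p S) (occ-total rng) ⟨
  sum (map (λ t → occ (suc t) S) (upTo p)) ℕ.+ misses p S
    ≡⟨ sum-map-+ (λ t → occ (suc t) S) (λ t → 1 ∸ occ (suc t) S) (upTo p) ⟨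
  sum (map (λ t → occ (suc t) S ℕ.+ (1 ∸ occ (suc t) S)) (upTo p))
    ≡⟨ cong sum (map-cong (λ t → m+[n∸m]≡n (occ-≤1 (suc t) inc)) (upTo p)) ⟩
  sum (map (λ _ → 1) (upTo p))
    ≡⟨ sum-const 1 (upTo p) ⟩
  1 ℕ.* length (upTo p)
    ≡⟨ trans (ℕP.*-identityˡ _) (length-upTo p) ⟩
  p ∎
  where open ≡-Reasoning

nua-insertAt : ∀ j x w → nua (insertAt j x w) ≡ isUp x ℕ.+ nua w
nua-insertAt zero    x w       = refl
nua-insertAt (suc j) x []      = refl
nua-insertAt (suc j) x (y ∷ w) =
  trans (cong (isUp y ℕ.+_) (nua-insertAt j x w)) (ℕ+.x∙yz≈y∙xz (isUp y) (isUp x) (nua w))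

nda-insertAt : ∀ j x w → nda (insertAt j x w) ≡ isDown x ℕ.+ nda w
nda-insertAt zero    x w       = refl
nda-insertAt (suc j) x []      = refl
nda-insertAt (suc j) x (y ∷ w) =
  trans (cong (isDown y ℕ.+_) (nda-insertAt j x w)) (ℕ+.x∙yz≈y∙xz (isDown y) (isDown x) (nda w))

+suc≡+1 : ∀ L → + L ℤ.+ ℤ.1ℤ ≡ + suc L
+suc≡+1 L = cong +_ (ℕP.+-comm L 1)

pred⇒suc : ∀ {L} k → + L ≡ k ℤ.- ℤ.1ℤ → + suc L ≡ k
pred⇒suc (+ suc j) refl = refl

suc⇒pred : ∀ {L k} → + suc L ≡ k → + L ≡ k ℤ.- ℤ.1ℤ
suc⇒pred refl = refl

gap : ∀ s m → + suc (s ℕ.+ m) ℤ.- + suc s ≡ + m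
gap s m = begin
  + suc (s ℕ.+ m) ℤ.- + suc s   ≡⟨ ℤP.[+m]-[+n]≡m⊖n (suc (s ℕ.+ m)) (suc s) ⟩
  suc (s ℕ.+ m) ℤ.⊖ suc s       ≡⟨ ℤP.[1+m]⊖[1+n]≡m⊖n (s ℕ.+ m) s ⟩
  s ℕ.+ m ℤ.⊖ s                 ≡⟨ ℤP.⊖-≥ (m≤m+n s m) ⟩
  + (s ℕ.+ m ∸ s)               ≡⟨ cong +_ (m+n∸m≡n s m) ⟩
  + m                           ∎
  where open ≡-Reasoning

Outside : ℕ → ℤ → Set
Outside n k = k ℤ.< + 0 ⊎ + n ℤ.≤ k

outside-weaken : ∀ {n k} → Outside (suc n) k → Outside n k
outside-weaken (inj₁ k<0)         = inj₁ k<0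
outside-weaken (inj₂ (ℤ.+≤+ n<k)) = inj₂ (ℤ.+≤+ (<⇒≤ n<k))

outside-pred : ∀ {n} k → Outside (suc n) k → Outside n (k ℤ.- ℤ.1ℤ)
outside-pred -[1+ j ]  _                        = inj₁ ℤ.-<+
outside-pred (+ j)     (inj₁ (ℤ.+<+ ()))
outside-pred (+ suc j) (inj₂ (ℤ.+≤+ (s≤s n≤j))) = inj₂ (ℤ.+≤+ n≤j)

outside-zero : ∀ {k} → Outside 1 k → + 0 ≢ k
outside-zero (inj₁ (ℤ.+<+ ()))  refl
outside-zero (inj₂ (ℤ.+≤+ ()))  refl

module Recurrence {r ℓ} (R : CommutativeRing r ℓ) (u d : CommutativeRing.Carrier R) where
  open CommutativeRing R
    renaming (refl to ≈-refl; sym to ≈-sym; trans to ≈-trans; reflexive to ≈-reflexive)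
  open Poly R
  open import Relation.Binary.Reasoning.Setoid setoid
  open import Algebra.Solver.Ring.NaturalCoefficients.Default commutativeSemiring
  import Algebra.Properties.CommutativeSemigroup (CommutativeRing.+-commutativeSemigroup R) as R+
  import Algebra.Properties.CommutativeSemigroup *-commutativeSemigroup as R*

  ∑ : ∀ {X : Set} → (X → Carrier) → List X → Carrier
  ∑ f xs = sumR (map f xs)

  fromℕ-+ : ∀ m n → fromℕ (m ℕ.+ n) ≈ fromℕ m + fromℕ n
  fromℕ-+ zero    n = ≈-sym (+-identityˡ (fromℕ n))
  fromℕ-+ (suc m) n = ≈-trans (+-congˡ (fromℕ-+ m n)) (≈-sym (+-assoc 1# (fromℕ m) (fromℕ n)))

  ∑-map : ∀ {X Y : Set} (f : Y → Carrier) (g : X → Y) xs → ∑ f (map g xs) ≡ ∑ (λ x → f (g x)) xs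
  ∑-map f g xs = cong sumR (sym (map-∘ xs))

  ∑-cong : ∀ {X : Set} {f g : X → Carrier} → (∀ x → f x ≈ g x) → ∀ xs → ∑ f xs ≈ ∑ g xs
  ∑-cong f≈g []       = ≈-refl
  ∑-cong f≈g (x ∷ xs) = +-cong (f≈g x) (∑-cong f≈g xs)

  ∑-congᴾ : ∀ {X : Set} {P : X → Set} {f g : X → Carrier} →
            (∀ {x} → P x → f x ≈ g x) → ∀ {xs} → All P xs → ∑ f xs ≈ ∑ g xs
  ∑-congᴾ f≈g []         = ≈-refl
  ∑-congᴾ f≈g (px ∷ pxs) = +-cong (f≈g px) (∑-congᴾ f≈g pxs)

  ∑-++ : ∀ {X : Set} (f : X → Carrier) xs ys → ∑ f (xs ++ ys) ≈ ∑ f xs + ∑ f ys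
  ∑-++ f []       ys = ≈-sym (+-identityˡ (∑ f ys))
  ∑-++ f (x ∷ xs) ys = ≈-trans (+-congˡ (∑-++ f xs ys)) (≈-sym (+-assoc (f x) (∑ f xs) (∑ f ys)))

  ∑-concatMap : ∀ {X Y : Set} (f : Y → Carrier) (g : X → List Y) xs →
                ∑ f (concatMap g xs) ≈ ∑ (λ x → ∑ f (g x)) xs
  ∑-concatMap f g []       = ≈-refl
  ∑-concatMap f g (x ∷ xs) = ≈-trans (∑-++ f (g x) (concatMap g xs)) (+-congˡ (∑-concatMap f g xs))

  ∑-+ : ∀ {X : Set} (f g : X → Carrier) xs → ∑ (λ x → f x + g x) xs ≈ ∑ f xs + ∑ g xs
  ∑-+ f g []       = ≈-sym (+-identityˡ 0#)
  ∑-+ f g (x ∷ xs) = ≈-trans (+-congˡ (∑-+ f g xs)) (R+.interchange (f x) (g x) (∑ f xs) (∑ g xs))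

  ∑-*ˡ : ∀ {X : Set} α (f : X → Carrier) xs → ∑ (λ x → α * f x) xs ≈ α * ∑ f xs
  ∑-*ˡ α f []       = ≈-sym (zeroʳ α)
  ∑-*ˡ α f (x ∷ xs) = ≈-trans (+-congˡ (∑-*ˡ α f xs)) (≈-sym (distribˡ α (f x) (∑ f xs)))

  ∑-*ʳ : ∀ {X : Set} (f : X → Carrier) β xs → ∑ (λ x → f x * β) xs ≈ ∑ f xs * β
  ∑-*ʳ f β []       = ≈-sym (zeroˡ β)
  ∑-*ʳ f β (x ∷ xs) = ≈-trans (+-congˡ (∑-*ʳ f β xs)) (≈-sym (distribʳ β (f x) (∑ f xs)))

  ∑-const : ∀ {X : Set} β (xs : List X) → ∑ (λ _ → β) xs ≈ fromℕ (length xs) * β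
  ∑-const β []       = ≈-sym (zeroˡ β)
  ∑-const β (x ∷ xs) = begin
    β + ∑ (λ _ → β) xs                  ≈⟨ +-cong (≈-sym (*-identityˡ β)) (∑-const β xs) ⟩
    1# * β + fromℕ (length xs) * β      ≈⟨ distribʳ β 1# (fromℕ (length xs)) ⟨
    (1# + fromℕ (length xs)) * β        ∎

  ∑-upTo-const : ∀ {f : ℕ → Carrier} {β} n → (∀ i → f i ≈ β) → ∑ f (upTo n) ≈ fromℕ n * β
  ∑-upTo-const {f} {β} n f≈β = begin
    ∑ f (upTo n)                       ≈⟨ ∑-cong f≈β (upTo n) ⟩
    ∑ (λ _ → β) (upTo n)               ≈⟨ ∑-const β (upTo n) ⟩
    fromℕ (length (upTo n)) * β        ≡⟨ cong (λ m → fromℕ m * β) (length-upTo n) ⟩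
    fromℕ n * β                        ∎

  ∑-fromℕ : ∀ {X : Set} (g : X → ℕ) xs → ∑ (λ x → fromℕ (g x)) xs ≈ fromℕ (sum (map g xs))
  ∑-fromℕ g []       = ≈-refl
  ∑-fromℕ g (x ∷ xs) = ≈-trans (+-congˡ (∑-fromℕ g xs)) (≈-sym (fromℕ-+ (g x) (sum (map g xs))))

  ∑-counts : ∀ {Z : Set} (f g : Z → ℕ) X Y xs →
             ∑ (λ z → fromℕ (f z) * X + fromℕ (g z) * Y) xs ≈ fromℕ (sum (map f xs)) * X + fromℕ (sum (map g xs)) * Y
  ∑-counts f g X Y xs = begin
    ∑ (λ z → fromℕ (f z) * X + fromℕ (g z) * Y) xs
      ≈⟨ ∑-+ (λ z → fromℕ (f z) * X) (λ z → fromℕ (g z) * Y) xs ⟩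
    ∑ (λ z → fromℕ (f z) * X) xs + ∑ (λ z → fromℕ (g z) * Y) xs
      ≈⟨ +-cong (∑-*ʳ (λ z → fromℕ (f z)) X xs) (∑-*ʳ (λ z → fromℕ (g z)) Y xs) ⟩
    ∑ (λ z → fromℕ (f z)) xs * X + ∑ (λ z → fromℕ (g z)) xs * Y
      ≈⟨ +-cong (*-congʳ (∑-fromℕ f xs)) (*-congʳ (∑-fromℕ g xs)) ⟩
    fromℕ (sum (map f xs)) * X + fromℕ (sum (map g xs)) * Y ∎

  -- The weight of a permutation depends only on its number L of ascents
  -- and its numbers a, b of up- and down-arrows.
  W : ℤ → ℕ → ℕ → ℕ → Carrier
  W k L a b with + L ℤ.≟ k
  ... | yes _ = pow u a * pow d b
  ... | no  _ = 0#

  weight≡W : ∀ k w S → weight k u d (w , S) ≡ W k (length S) (nua w) (nda w)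
  weight≡W k w S with + length S ℤ.≟ k
  ... | yes _ = refl
  ... | no  _ = refl

  weight-shape : ∀ k (π : GP) {L a b} → length (proj₂ π) ≡ L → nua (proj₁ π) ≡ a → nda (proj₁ π) ≡ b →
                 weight k u d π ≈ W k L a b
  weight-shape k (w , S) refl refl refl = ≈-reflexive (weight≡W k w S)

  W-up : ∀ k L a b → W k L (suc a) b ≈ u * W k L a b
  W-up k L a b with + L ℤ.≟ k
  ... | yes _ = *-assoc u (pow u a) (pow d b)
  ... | no  _ = ≈-sym (zeroʳ u)

  W-down : ∀ k L a b → W k L a (suc b) ≈ d * W k L a b
  W-down k L a b with + L ℤ.≟ k
  ... | yes _ = R*.x∙yz≈y∙xz (pow u a) d (pow d b)
  ... | no  _ = ≈-sym (zeroʳ d)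

  W-zero : ∀ k L a b → + L ≢ k → W k L a b ≈ 0#
  W-zero k L a b L≢k with + L ℤ.≟ k
  ... | yes L≡k = ⊥-elim (L≢k L≡k)
  ... | no  _   = ≈-refl

  W-scale : ∀ k L a b {x y} → (+ L ≡ k → x ≈ y) → x * W k L a b ≈ y * W k L a b
  W-scale k L a b x≈y with + L ℤ.≟ k
  ... | yes L≡k = *-congʳ (x≈y L≡k)
  ... | no  _   = ≈-trans (zeroʳ _) (≈-sym (zeroʳ _))

  W-pred : ∀ k L a b → W (k ℤ.- ℤ.1ℤ) L a b ≡ W k (suc L) a b
  W-pred k L a b with + L ℤ.≟ k ℤ.- ℤ.1ℤ | + suc L ℤ.≟ k
  ... | yes _      | yes _      = refl
  ... | no  _      | no  _      = refl
  ... | yes L≡k-1  | no  L+1≢k  = ⊥-elim (L+1≢k (pred⇒suc k L≡k-1))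
  ... | no  L≢k-1  | yes L+1≡k  = ⊥-elim (L≢k-1 (suc⇒pred L+1≡k))

  -- With c ∈ {0, 1}, the weight at s + 1 - c ascents as a combination of
  -- the weights at s and s + 1 ascents (rule (i), c = [t ∈ S]).
  W-dichotomy : ∀ k {L s} a b c → c ≤ 1 → L ℕ.+ c ≡ suc s →
                W k L a b ≈ fromℕ c * W k s a b + fromℕ (1 ∸ c) * W k (suc s) a b
  W-dichotomy k {L} {s} a b zero _ L+0≡1+s
    rewrite trans (sym (ℕP.+-identityʳ L)) L+0≡1+s = begin
      W k (suc s) a b                              ≈⟨ +-identityʳ _ ⟨
      W k (suc s) a b + 0#                         ≈⟨ +-comm _ 0# ⟩
      0# + W k (suc s) a b                         ≈⟨ +-cong (zeroˡ _) (*-identityˡ _) ⟨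
      0# * W k s a b + 1# * W k (suc s) a b        ≈⟨ +-congˡ (*-congʳ (+-identityʳ 1#)) ⟨
      fromℕ 0 * W k s a b + fromℕ 1 * W k (suc s) a b ∎
  W-dichotomy k {L} {s} a b (suc zero) _ L+1≡1+s
    rewrite ℕP.suc-injective (trans (ℕP.+-comm 1 L) L+1≡1+s) = begin
      W k s a b                                    ≈⟨ +-identityʳ _ ⟨
      W k s a b + 0#                               ≈⟨ +-cong (*-identityˡ _) (zeroˡ _) ⟨
      1# * W k s a b + 0# * W k (suc s) a b        ≈⟨ +-congʳ (*-congʳ (+-identityʳ 1#)) ⟨
      fromℕ 1 * W k s a b + fromℕ 0 * W k (suc s) a b ∎
  W-dichotomy k a b (suc (suc c)) (s≤s ()) _

  -- The children of one permutation π = (w , S) with p letters, s ascents,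
  -- a up-arrows and b down-arrows.  X is the k-weight of π and Y the
  -- k-weight that π would have with one more ascent.
  module Children (k : ℤ) (p : ℕ) (w : List Tile) (S : List ℕ) where

    s a b : ℕ
    s = length S
    a = nua w
    b = nda w

    X Y : Carrier
    X = W k s a b
    Y = W k (suc s) a b

    wt : GP → Carrier
    wt = weight k u d

    plain-child up-child down-child : ℕ → GP
    plain-child j = insertAt j (suc p , unmarked) w , ascI j S
    up-child    i = insertAt i (suc p , up) w , ascII (suc i) S
    down-child  i = insertAt i (suc p , down) w , ascIII (suc i) S

    -- Gap 0 adds no ascent; a positive gap t adds one unless t ∈ S.  Of the
    -- gaps 1, …, p exactly s lie in S and misses p S = p - s do not.
    plain-sum : AscentSet p S → ∑ wt (map plain-child (upTo (suc p))) ≈ X + (fromℕ s * X + fromℕ (misses p S) * Y)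
    plain-sum (inc , rng) = begin
      wt (plain-child 0) + ∑ wt (map plain-child (applyUpTo suc p))
        ≡⟨ cong (λ ts → wt (plain-child 0) + ∑ wt ts) (map-applyUpTo-suc plain-child p) ⟩
      wt (plain-child 0) + ∑ wt (map (λ t → plain-child (suc t)) (upTo p))
        ≡⟨ cong (λ z → wt (plain-child 0) + z) (∑-map wt (λ t → plain-child (suc t)) (upTo p)) ⟩
      wt (plain-child 0) + ∑ (λ t → wt (plain-child (suc t))) (upTo p)
        ≈⟨ +-cong (weight-shape k (plain-child 0) (length-map suc S) refl refl) (∑-cong gap-weight (upTo p)) ⟩
      X + ∑ (λ t → fromℕ (inS t) * X + fromℕ (1 ∸ inS t) * Y) (upTo p)
        ≈⟨ +-congˡ (∑-counts inS (λ t → 1 ∸ inS t) X Y (upTo p)) ⟩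
      X + (fromℕ (sum (map inS (upTo p))) * X + fromℕ (misses p S) * Y)
        ≡⟨ cong (λ n → X + (fromℕ n * X + fromℕ (misses p S) * Y)) (occ-total rng) ⟩
      X + (fromℕ s * X + fromℕ (misses p S) * Y) ∎
      where
      inS : ℕ → ℕ
      inS t = occ (suc t) S

      gap-weight : ∀ t → wt (plain-child (suc t)) ≈ fromℕ (inS t) * X + fromℕ (1 ∸ inS t) * Y
      gap-weight t = ≈-trans
        (weight-shape k (plain-child (suc t)) refl (nua-insertAt (suc t) (suc p , unmarked) w) (nda-insertAt (suc t) (suc p , unmarked) w))
        (W-dichotomy k a b (inS t) (occ-≤1 (suc t) inc) (length-ascI t S))

    -- An up-arrow always adds an ascent, a down-arrow never does.
    up-sum : ∑ wt (map up-child (upTo p)) ≈ fromℕ p * (u * Y)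
    up-sum = ≈-trans (≈-reflexive (∑-map wt up-child (upTo p))) (∑-upTo-const p λ i → ≈-trans
      (weight-shape k (up-child i) (length-ascII (suc i) S) (nua-insertAt i (suc p , up) w) (nda-insertAt i (suc p , up) w))
      (W-up k (suc s) a b))

    down-sum : ∑ wt (map down-child (upTo p)) ≈ fromℕ p * (d * X)
    down-sum = ≈-trans (≈-reflexive (∑-map wt down-child (upTo p))) (∑-upTo-const p λ i → ≈-trans
      (weight-shape k (down-child i) (length-ascIII (suc i) S) (nua-insertAt i (suc p , down) w) (nda-insertAt i (suc p , down) w))
      (W-down k s a b))

    children-sum : AscentSet p S →
      ∑ wt (children p (w , S)) ≈
        (fromℤ (k ℤ.+ ℤ.1ℤ) + fromℕ p * d) * weight k u d (w , S)
        + (fromℤ (+ suc p ℤ.- k) + fromℕ p * u) * weight (k ℤ.- ℤ.1ℤ) u d (w , S)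
    children-sum AS = begin
      ∑ wt (plain ++ ups ++ downs)
        ≈⟨ ≈-trans (∑-++ wt plain (ups ++ downs)) (+-congˡ (∑-++ wt ups downs)) ⟩
      ∑ wt plain + (∑ wt ups + ∑ wt downs)
        ≈⟨ +-cong (plain-sum AS) (+-cong up-sum down-sum) ⟩
      (X + (fromℕ s * X + fromℕ m * Y)) + (fromℕ p * (u * Y) + fromℕ p * (d * X))
        ≈⟨ collect X Y (fromℕ s) (fromℕ m) (fromℕ p) u d ⟩
      ((1# + fromℕ s) + fromℕ p * d) * X + (fromℕ m + fromℕ p * u) * Y
        ≈⟨ +-cong (W-scale k s a b (λ { refl → +-congʳ (≈-reflexive ascents+1) }))
                  (W-scale k (suc s) a b (λ { refl → +-congʳ (≈-reflexive non-ascents) })) ⟩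
      (fromℤ (k ℤ.+ ℤ.1ℤ) + fromℕ p * d) * X + (fromℤ (+ suc p ℤ.- k) + fromℕ p * u) * Y
        ≡⟨ cong₂ (λ x y → (fromℤ (k ℤ.+ ℤ.1ℤ) + fromℕ p * d) * x + (fromℤ (+ suc p ℤ.- k) + fromℕ p * u) * y)
                 (sym (weight≡W k w S)) (sym (trans (weight≡W (k ℤ.- ℤ.1ℤ) w S) (W-pred k s a b))) ⟩
      (fromℤ (k ℤ.+ ℤ.1ℤ) + fromℕ p * d) * weight k u d (w , S)
        + (fromℤ (+ suc p ℤ.- k) + fromℕ p * u) * weight (k ℤ.- ℤ.1ℤ) u d (w , S) ∎
      where
      plain ups downs : List GP
      plain = map plain-child (upTo (suc p))
      ups   = map up-child (upTo p)
      downs = map down-child (upTo p)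

      m : ℕ
      m = misses p S

      collect : ∀ X Y s m p u d →
        (X + (s * X + m * Y)) + (p * (u * Y) + p * (d * X)) ≈ ((1# + s) + p * d) * X + (m + p * u) * Y
      collect = solve 7 (λ X Y s m p u d →
        (X :+ (s :* X :+ m :* Y)) :+ (p :* (u :* Y) :+ p :* (d :* X))
          := ((con 1 :+ s) :+ p :* d) :* X :+ (m :+ p :* u) :* Y) ≈-refl

      -- If π has s = k ascents, the coefficient 1 + s of X is k + 1.
      ascents+1 : 1# + fromℕ s ≡ fromℤ (+ s ℤ.+ ℤ.1ℤ)
      ascents+1 = sym (cong fromℤ (+suc≡+1 s))

      -- If π has s = k - 1 ascents, the coefficient p - s of Y is p + 1 - k.
      non-ascents : fromℕ m ≡ fromℤ (+ suc p ℤ.- + suc s)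
      non-ascents = sym (trans (cong (λ q → fromℤ (+ suc q ℤ.- + suc s)) (sym (occ-total+misses AS)))
                               (cong fromℤ (gap s m)))

  α β : ℕ → ℤ → Carrier
  α m k = fromℤ (k ℤ.+ ℤ.1ℤ) + fromℕ (suc m) * d
  β m k = fromℤ (+ suc (suc m) ℤ.- k) + fromℕ (suc m) * u

  -- Every permutation with m + 2 letters is a child of exactly one
  -- permutation with m + 1 letters, so A(m + 2, k) is the sum over
  -- π ∈ GS (m + 1) of the contributions computed in children-sum.
  recurrence : ∀ m k → A (suc (suc m)) k u d ≈ α m k * A (suc m) k u d + β m k * A (suc m) (k ℤ.- ℤ.1ℤ) u d
  recurrence m k = begin
    ∑ wk (concatMap (children (suc m)) (GS (suc m)))
      ≈⟨ ∑-concatMap wk (children (suc m)) (GS (suc m)) ⟩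
    ∑ (λ π → ∑ wk (children (suc m) π)) (GS (suc m))
      ≈⟨ ∑-congᴾ (λ {π} → Children.children-sum k (suc m) (proj₁ π) (proj₂ π)) (ascentSets-GS m) ⟩
    ∑ (λ π → α m k * wk π + β m k * wk′ π) (GS (suc m))
      ≈⟨ ∑-+ (λ π → α m k * wk π) (λ π → β m k * wk′ π) (GS (suc m)) ⟩
    ∑ (λ π → α m k * wk π) (GS (suc m)) + ∑ (λ π → β m k * wk′ π) (GS (suc m))
      ≈⟨ +-cong (∑-*ˡ (α m k) wk (GS (suc m))) (∑-*ˡ (β m k) wk′ (GS (suc m))) ⟩
    α m k * A (suc m) k u d + β m k * A (suc m) (k ℤ.- ℤ.1ℤ) u d ∎
    where
    wk wk′ : GP → Carrier
    wk  = weight k u d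
    wk′ = weight (k ℤ.- ℤ.1ℤ) u d

  initial : A 1 (+ 0) u d ≈ 1#
  initial = ≈-trans (+-identityʳ _) (*-identityˡ 1#)

  vanishing : ∀ n k → 1 ≤ n → Outside n k → A n k u d ≈ 0#
  vanishing (suc zero) k _ out =
    ≈-trans (+-identityʳ _) (≈-trans (≈-reflexive (weight≡W k _ [])) (W-zero k 0 0 0 (outside-zero out)))
  vanishing (suc (suc m)) k _ out = begin
    A (suc (suc m)) k u d                                     ≈⟨ recurrence m k ⟩
    α m k * A (suc m) k u d + β m k * A (suc m) (k ℤ.- ℤ.1ℤ) u d
      ≈⟨ +-cong (*-congˡ (vanishing (suc m) k (s≤s z≤n) (outside-weaken out)))
                (*-congˡ (vanishing (suc m) (k ℤ.- ℤ.1ℤ) (s≤s z≤n) (outside-pred k out))) ⟩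
    α m k * 0# + β m k * 0#                                   ≈⟨ +-cong (zeroʳ (α m k)) (zeroʳ (β m k)) ⟩
    0# + 0#                                                   ≈⟨ +-identityʳ 0# ⟩
    0#                                                        ∎

mainTheorem3 : ∀ {c ℓ} (R : CommutativeRing c ℓ) (u d : CommutativeRing.Carrier R) →
    let open CommutativeRing R
        open Poly R
    in (A 1 (+ 0) u d ≈ 1#)
       × (∀ (n : ℕ) (k : ℤ) → 1 ≤ n → (k ℤ.< + 0 ⊎ + n ℤ.≤ k) → A n k u d ≈ 0#)
       × (∀ (n : ℕ) (k : ℤ) → 2 ≤ n →
            A n k u d ≈ (fromℤ (k ℤ.+ ℤ.1ℤ) + fromℕ (n ∸ 1) * d) * A (n ∸ 1) k u d
                        + (fromℤ (+ n ℤ.- k) + fromℕ (n ∸ 1) * u) * A (n ∸ 1) (k ℤ.- ℤ.1ℤ) u d)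
mainTheorem3 R u d = initial , vanishing , λ { (suc (suc m)) k (s≤s (s≤s z≤n)) → recurrence m k }
  where open Recurrence R u d
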